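{- Let $n\ge 1$, let $\pi=\pi_1\pi_2\cdots\pi_n\in\mathcal S_n$ with $\pi_1=i$, and let $\pi'=\mathrm{red}(\pi_2\cdots\pi_n)\in\mathcal S_{n-1}$. Then $$\mathrm{weight}(\pi)=x_1x_2\cdots x_{i-1}\cdot \mathrm{weight}(\pi')\Big|_{x_j\to t\,x_{j+1}\ (i\le j\le n-1)},$$ where the substitution replaces simultaneously each $x_j$ with $i\le j\le n-1$ by $t\,x_{j+1}$ and leaves $x_1,\dots,x_{i-1}$ unchanged.
   Context: For a sequence $\sigma=\sigma_1\cdots\sigma_k$ of distinct positive integers, $\mathrm{red}(\sigma)$ is the unique permutation $\tau\in\mathcal S_k$ with $\sigma_a<\sigma_b \iff \tau_a<\tau_b$ for all $a,b$. For a permutation $\pi\in\mathcal S_m$, $N_{132}(\pi)$ is the number of index triples $a<b<c$ with $\mathrm{red}(\pi_a\pi_b\pi_c)=132$. For $\pi\in\mathcal S_m$ define, in the polynomial ring in $t,x_1,x_2,\dots$, $$\mathrm{weight}(\pi)=t^{N_{132}(\pi)}\prod_{i=1}^{m}x_i^{\#\{(a,b):\,1\le a<b\le m,\ \pi_a>\pi_b=i\}}.$$ -}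

module Defs where

open import Data.Nat using (ℕ; zero; suc; _<_; _≤_; _<?_; _≤?_)
import Data.Nat as ℕ
open import Data.Fin using (Fin; toℕ)
import Data.Fin as F
open import Data.Fin.Permutation using (Permutation′; _⟨$⟩ʳ_)
open import Data.Product using (_×_)
open import Relation.Nullary using (Dec; yes; no)
open import Algebra.Bundles using (CommutativeSemiring)

ind : ∀ {p} {P : Set p} → Dec P → ℕ
ind (yes _) = 1
ind (no _)  = 0

sumFin : ∀ {m} → (Fin m → ℕ) → ℕ
sumFin {zero}  f = 0
sumFin {suc m} f = f F.zero ℕ.+ sumFin (λ a → f (F.suc a))

-- 1-based value π_a of a permutation π ∈ S_m (stdlib permutations act on Fin m = {0..m-1})
val : ∀ {m} → Permutation′ m → Fin m → ℕ
val π a = suc (toℕ (π ⟨$⟩ʳ a))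

N132 : ∀ {m} → Permutation′ m → ℕ
N132 π = sumFin λ a → sumFin λ b → sumFin λ c →
  ind (toℕ a <? toℕ b) ℕ.* ind (toℕ b <? toℕ c)
  ℕ.* ind (val π a <? val π c) ℕ.* ind (val π c <? val π b)

invAt : ∀ {m} → Permutation′ m → ℕ → ℕ
invAt π i = sumFin λ a → sumFin λ b →
  ind (toℕ a <? toℕ b) ℕ.* ind (val π b <? val π a) ℕ.* ind (val π b ℕ.≟ i)

IsRedTail : ∀ {n} → Permutation′ (suc n) → Permutation′ n → Set
IsRedTail {n} π π' = (a b : Fin n) →
  ((val π' a < val π' b) → (val π (F.suc a) < val π (F.suc b)))
  × ((val π (F.suc a) < val π (F.suc b)) → (val π' a < val π' b))

-- Evaluation of monomials in an arbitrary commutative semiring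
-- (an identity of monomials in ℤ[t,x₁,x₂,…] holds iff it holds under all such evaluations).
module _ {c ℓ} (R : CommutativeSemiring c ℓ) where
  open CommutativeSemiring R

  pow : Carrier → ℕ → Carrier
  pow r zero    = 1#
  pow r (suc k) = r * pow r k

  prodUpTo : ℕ → (ℕ → Carrier) → Carrier
  prodUpTo zero    f = 1#
  prodUpTo (suc m) f = prodUpTo m f * f (suc m)

  weight : Carrier → (ℕ → Carrier) → ∀ {m} → Permutation′ m → Carrier
  weight t x {m} π = pow t (N132 π) * prodUpTo m (λ i → pow (x i) (invAt π i))

  substX : Carrier → (ℕ → Carrier) → (i N : ℕ) → ℕ → Carrier
  substX t x i N j with j <? i | j ≤? N
  ... | yes _ | _     = x j
  ... | no _  | yes _ = t * x (suc j)
  ... | no _  | no _  = x j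

-- Sort the 132-occurrences and the inversions of π by whether they use the first
-- position.  An inversion (1, b) contributes x_{π_b} exactly when π_b < i, which
-- gives x₁ ⋯ x_{i-1}.  A 132-occurrence (1, b, c) is exactly an inversion (b, c) of
-- the tail with π_c > i.  All other inversions and occurrences are those of π',
-- transported along π'_b ↦ π_{b+1}, which is π'_b + 1 when π_{b+1} > i and π'_b
-- otherwise.  Hence the substitution x_j ↦ t x_{j+1} (j ≥ i) turns the variable
-- x_{π'_c} of an inversion (b, c) of π' into x_{π_{c+1}}, times t precisely when
-- (1, b+1, c+1) is a 132-occurrence of π.
module Submission where

open import Defs
open import Data.Nat using (ℕ; suc; _∸_)
open import Data.Fin using (Fin; zero)
open import Data.Fin.Permutation using (Permutation′)
open import Algebra.Bundles using (CommutativeSemiring)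

open import Data.Nat as ℕ using (zero; _+_; _<_; _≤_; _<?_; z≤n; s≤s)
import Data.Nat.Properties as ℕₚ
open import Data.Fin as F using (toℕ)
open import Data.Fin.Properties using (toℕ<n; toℕ-injective; toℕ-inject₁; toℕ-fromℕ; punchInᵢ≢i)
open import Data.Fin.Permutation using (_⟨$⟩ʳ_)
open import Function.Bundles using (Injection)
open import Function.Properties.Inverse using (↔⇒↣)
open import Data.Product using (proj₁; proj₂)
open import Data.Sum using (inj₁; inj₂)
open import Data.Empty using (⊥-elim)
open import Relation.Nullary using (Dec; yes; no; ¬_)
open import Relation.Binary.PropositionalEquality
  using (_≡_; _≢_; refl; cong; cong₂; sym; trans; subst; module ≡-Reasoning)
open import Algebra.Properties.CommutativeSemigroup ℕₚ.*-commutativeSemigroup using (xy∙z≈xz∙y)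
import Algebra.Properties.CommutativeMonoid.Sum as CommutativeMonoidSum
import Algebra.Properties.CommutativeSemiring.Exp as CommutativeSemiringExp
import Algebra.Solver.CommutativeMonoid as CommutativeMonoidSolver
import Relation.Binary.Reasoning.Setoid as SetoidReasoning

ind-cong : ∀ {p q} {P : Set p} {Q : Set q} → (P → Q) → (Q → P) →
           (d : Dec P) (e : Dec Q) → ind d ≡ ind e
ind-cong f g (yes p) (yes q) = refl
ind-cong f g (yes p) (no ¬q) = ⊥-elim (¬q (f p))
ind-cong f g (no ¬p) (yes q) = ⊥-elim (¬p (g q))
ind-cong f g (no _)  (no _)  = refl

ind-yes : ∀ {p} {P : Set p} → P → (d : Dec P) → ind d ≡ 1
ind-yes p (yes _) = refl
ind-yes p (no ¬p) = ⊥-elim (¬p p)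

ind-no : ∀ {p} {P : Set p} → ¬ P → (d : Dec P) → ind d ≡ 0
ind-no ¬p (yes p) = ⊥-elim (¬p p)
ind-no ¬p (no _)  = refl

ind-suc-< : ∀ {m} (a b : Fin m) → ind (toℕ (F.suc a) <? toℕ (F.suc b)) ≡ ind (toℕ a <? toℕ b)
ind-suc-< a b = ind-cong ℕₚ.≤-pred s≤s _ _

sumFin-cong : ∀ {m} {f g : Fin m → ℕ} → (∀ a → f a ≡ g a) → sumFin f ≡ sumFin g
sumFin-cong {zero}  h = refl
sumFin-cong {suc m} h = cong₂ _+_ (h zero) (sumFin-cong (λ a → h (F.suc a)))

sumFin-zero : ∀ {m} {f : Fin m → ℕ} → (∀ a → f a ≡ 0) → sumFin f ≡ 0
sumFin-zero {zero}  h = refl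
sumFin-zero {suc m} h = cong₂ _+_ (h zero) (sumFin-zero (λ a → h (F.suc a)))

module ℕΣ = CommutativeMonoidSum ℕₚ.+-0-commutativeMonoid

sumFin≡sum : ∀ {m} (f : Fin m → ℕ) → sumFin f ≡ ℕΣ.sum f
sumFin≡sum {zero}  f = refl
sumFin≡sum {suc m} f = cong (f zero +_) (sumFin≡sum (λ a → f (F.suc a)))

sumFin-permute : ∀ {m} (σ : Permutation′ m) (g : Fin m → ℕ) →
                 sumFin (λ b → g (σ ⟨$⟩ʳ b)) ≡ sumFin g
sumFin-permute σ g = begin
  sumFin (λ b → g (σ ⟨$⟩ʳ b)) ≡⟨ sumFin≡sum (λ b → g (σ ⟨$⟩ʳ b)) ⟩
  ℕΣ.sum (λ b → g (σ ⟨$⟩ʳ b)) ≡⟨ sym (ℕΣ.∑-permute g σ) ⟩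
  ℕΣ.sum g                    ≡⟨ sym (sumFin≡sum g) ⟩
  sumFin g                    ∎
  where open ≡-Reasoning

sumFin-ind-< : ∀ {m k} → k ≤ m → sumFin {m} (λ d → ind (toℕ d <? k)) ≡ k
sumFin-ind-< {zero}  {zero}  z≤n = refl
sumFin-ind-< {suc m} {zero}  _   =
  sumFin-zero {suc m} (λ d → ind-no ℕₚ.n≮0 (toℕ d <? 0))
sumFin-ind-< {suc m} {suc k} (s≤s k≤m) = cong₂ _+_ (ind-yes (s≤s z≤n) (0 <? suc k))
  (trans (sumFin-cong {m} (λ d → ind-cong ℕₚ.≤-pred s≤s (suc (toℕ d) <? suc k) (toℕ d <? k)))
         (sumFin-ind-< k≤m))

toℕ-rank : ∀ {m} (σ : Permutation′ m) (c : Fin m) →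
           sumFin (λ b → ind (toℕ (σ ⟨$⟩ʳ b) <? toℕ (σ ⟨$⟩ʳ c))) ≡ toℕ (σ ⟨$⟩ʳ c)
toℕ-rank σ c = trans (sumFin-permute σ (λ d → ind (toℕ d <? toℕ (σ ⟨$⟩ʳ c))))
                     (sumFin-ind-< (ℕₚ.<⇒≤ (toℕ<n (σ ⟨$⟩ʳ c))))

val-injective : ∀ {m} (σ : Permutation′ m) {a b : Fin m} → val σ a ≡ val σ b → a ≡ b
val-injective σ eq = Injection.injective (↔⇒↣ σ) (toℕ-injective (ℕₚ.suc-injective eq))

inversion : ∀ {m} → Permutation′ m → Fin m → Fin m → ℕ
inversion σ a b = ind (toℕ a <? toℕ b) ℕ.* ind (val σ b <? val σ a)

occ132 : ∀ {m} → Permutation′ m → Fin m → Fin m → Fin m → ℕ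
occ132 σ a b c = ind (toℕ a <? toℕ b) ℕ.* ind (toℕ b <? toℕ c)
                 ℕ.* ind (val σ a <? val σ c) ℕ.* ind (val σ c <? val σ b)

inversion-to-zero : ∀ {m} (σ : Permutation′ (suc m)) a → inversion σ a zero ≡ 0
inversion-to-zero σ a = cong (ℕ._* ind (val σ zero <? val σ a)) (ind-no ℕₚ.n≮0 (toℕ a <? 0))

inversion-from-zero : ∀ {m} (σ : Permutation′ (suc m)) b →
                      inversion σ zero b ≡ ind (val σ b <? val σ zero)
inversion-from-zero σ zero = sym (ind-no (ℕₚ.<-irrefl refl) (val σ zero <? val σ zero))
inversion-from-zero σ (F.suc b) =
  trans (cong (ℕ._* ind (val σ (F.suc b) <? val σ zero)) (ind-yes (s≤s z≤n) (0 <? suc (toℕ b))))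
        (ℕₚ.*-identityˡ _)

occ132-zero-middle : ∀ {m} (σ : Permutation′ (suc m)) a c → occ132 σ a zero c ≡ 0
occ132-zero-middle σ a c rewrite ind-no ℕₚ.n≮0 (toℕ a <? 0) = refl

occ132-zero-last : ∀ {m} (σ : Permutation′ (suc m)) a b → occ132 σ a (F.suc b) zero ≡ 0
occ132-zero-last σ a b
  rewrite ind-no ℕₚ.n≮0 (suc (toℕ b) <? 0) | ℕₚ.*-zeroʳ (ind (toℕ a <? suc (toℕ b))) = refl

module HeadTail {n} (π : Permutation′ (suc n)) (π' : Permutation′ n) (red : IsRedTail π π') where

  i : ℕ
  i = val π zero

  above : Fin n → ℕ
  above b = ind (i <? val π (F.suc b))

  tail-order : ∀ a b → ind (val π (F.suc a) <? val π (F.suc b)) ≡ ind (val π' a <? val π' b)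
  tail-order a b = ind-cong (proj₂ (red a b)) (proj₁ (red a b)) _ _

  inversion-tail : ∀ a b → inversion π (F.suc a) (F.suc b) ≡ inversion π' a b
  inversion-tail a b = cong₂ ℕ._*_ (ind-suc-< a b) (tail-order b a)

  occ132-tail : ∀ a b c → occ132 π (F.suc a) (F.suc b) (F.suc c) ≡ occ132 π' a b c
  occ132-tail a b c =
    cong₂ ℕ._*_ (cong₂ ℕ._*_ (cong₂ ℕ._*_ (ind-suc-< a b) (ind-suc-< b c)) (tail-order a c))
                (tail-order c b)

  occ132-head : ∀ b c → occ132 π zero (F.suc b) (F.suc c) ≡ inversion π' b c ℕ.* above c
  occ132-head b c = begin
    occ132 π zero (F.suc b) (F.suc c)
      ≡⟨ cong₂ ℕ._*_ (cong₂ ℕ._*_ (cong₂ ℕ._*_ (ind-yes (s≤s z≤n) (0 <? suc (toℕ b)))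
                                                (ind-suc-< b c)) refl)
                     (tail-order c b) ⟩
    1 ℕ.* ind (toℕ b <? toℕ c) ℕ.* above c ℕ.* ind (val π' c <? val π' b)
      ≡⟨ cong (λ u → u ℕ.* above c ℕ.* ind (val π' c <? val π' b)) (ℕₚ.*-identityˡ (ind (toℕ b <? toℕ c))) ⟩
    ind (toℕ b <? toℕ c) ℕ.* above c ℕ.* ind (val π' c <? val π' b)
      ≡⟨ xy∙z≈xz∙y (ind (toℕ b <? toℕ c)) (above c) (ind (val π' c <? val π' b)) ⟩
    inversion π' b c ℕ.* above c ∎
    where open ≡-Reasoning

  headOccurrences : ℕ
  headOccurrences = sumFin λ b → sumFin λ c → inversion π' b c ℕ.* above c

  N132-head-tail : N132 π ≡ headOccurrences + N132 π'
  N132-head-tail = cong₂ _+_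
    (trans (skipZero zero) (sumFin-cong λ b → sumFin-cong λ c → occ132-head b c))
    (sumFin-cong λ a → trans (skipZero (F.suc a))
                             (sumFin-cong λ b → sumFin-cong λ c → occ132-tail a b c))
    where
    skipZero : ∀ a → sumFin (λ b → sumFin λ c → occ132 π a b c)
                     ≡ sumFin (λ b → sumFin λ c → occ132 π a (F.suc b) (F.suc c))
    skipZero a = cong₂ _+_ (sumFin-zero {suc n} (occ132-zero-middle π a))
                           (sumFin-cong {n} λ b →
                             cong (_+ sumFin (λ c → occ132 π a (F.suc b) (F.suc c)))
                                  (occ132-zero-last π a b))

  toℕ-tail : ∀ b → toℕ (π ⟨$⟩ʳ F.suc b) ≡ above b + toℕ (π' ⟨$⟩ʳ b)
  toℕ-tail b = trans (sym (toℕ-rank π (F.suc b)))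
    (cong₂ _+_ (ind-cong s≤s ℕₚ.≤-pred _ _)
      (trans (sumFin-cong λ a → ind-cong (λ h → ℕₚ.≤-pred (proj₂ (red a b) (s≤s h)))
                                          (λ h → ℕₚ.≤-pred (proj₁ (red a b) (s≤s h))) _ _)
             (toℕ-rank π' b)))

  val-tail-above : ∀ b → i < val π (F.suc b) → val π (F.suc b) ≡ suc (val π' b)
  val-tail-above b h = cong suc (trans (toℕ-tail b) (cong (_+ toℕ (π' ⟨$⟩ʳ b)) (ind-yes h _)))

  val-tail-below : ∀ b → ¬ i < val π (F.suc b) → val π (F.suc b) ≡ val π' b
  val-tail-below b h = cong suc (trans (toℕ-tail b) (cong (_+ toℕ (π' ⟨$⟩ʳ b)) (ind-no h _)))

  val-tail≢head : ∀ b → val π (F.suc b) ≢ i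
  val-tail≢head b eq with val-injective π eq
  ... | ()

module _ {c ℓ} (R : CommutativeSemiring c ℓ) where
  open CommutativeSemiring R
    using (Carrier; _≈_; _*_; 1#; setoid; *-cong; *-congˡ; *-congʳ;
           *-identityˡ; *-identityʳ; *-commutativeMonoid)
    renaming (refl to ≈-refl; sym to ≈-sym; trans to ≈-trans; reflexive to ≈-reflexive)
  open CommutativeSemiringExp R using (_^_; ^-congˡ; ^-homo-*; ^-assocʳ; ^-distrib-*)
  open CommutativeMonoidSum *-commutativeMonoid
    using () renaming (sum to ∏; sum-cong-≋ to ∏-cong; sum-remove to ∏-remove;
                       sum-replicate-zero to ∏-replicate-1; sum-init-last to ∏-init-last;
                       ∑-distrib-+ to ∏-distrib-*; ∑-comm to ∏-comm; ∑-permute to ∏-permute)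
  open SetoidReasoning setoid

  infixl 10 ∏-syntax
  ∏-syntax : ∀ m → (Fin m → Carrier) → Carrier
  ∏-syntax m = ∏ {m}
  syntax ∏-syntax m (λ d → e) = ∏[ d < m ] e

  pow≡^ : ∀ r k → pow R r k ≡ r ^ k
  pow≡^ r zero    = refl
  pow≡^ r (suc k) = cong (r *_) (pow≡^ r k)

  pow-congˡ : ∀ {r s} k → r ≈ s → pow R r k ≈ pow R s k
  pow-congˡ {r} {s} k r≈s rewrite pow≡^ r k | pow≡^ s k = ^-congˡ k r≈s

  pow-homo-+ : ∀ r k l → pow R r (k + l) ≈ pow R r k * pow R r l
  pow-homo-+ r k l rewrite pow≡^ r (k + l) | pow≡^ r k | pow≡^ r l = ^-homo-* r k l

  pow-assocʳ : ∀ r k l → pow R (pow R r k) l ≈ pow R r (k ℕ.* l)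
  pow-assocʳ r k l rewrite pow≡^ (pow R r k) l | pow≡^ r k | pow≡^ r (k ℕ.* l) = ^-assocʳ r k l

  pow-distrib-* : ∀ r s k → pow R (r * s) k ≈ pow R r k * pow R s k
  pow-distrib-* r s k rewrite pow≡^ (r * s) k | pow≡^ r k | pow≡^ s k = ^-distrib-* r s k

  pow-sumFin : ∀ {m} r (f : Fin m → ℕ) → pow R r (sumFin f) ≈ ∏[ a < m ] pow R r (f a)
  pow-sumFin {zero}  r f = ≈-refl
  pow-sumFin {suc m} r f =
    ≈-trans (pow-homo-+ r (f zero) _) (*-congˡ (pow-sumFin r (λ a → f (F.suc a))))

  prodUpTo-cong : ∀ m {f g : ℕ → Carrier} → (∀ j → j ≤ m → f j ≈ g j) →
                  prodUpTo R m f ≈ prodUpTo R m g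
  prodUpTo-cong zero    h = ≈-refl
  prodUpTo-cong (suc m) h =
    *-cong (prodUpTo-cong m (λ j j≤m → h j (ℕₚ.m≤n⇒m≤1+n j≤m))) (h (suc m) ℕₚ.≤-refl)

  prodUpTo≈∏ : ∀ m (f : ℕ → Carrier) → prodUpTo R m f ≈ ∏[ d < m ] f (suc (toℕ d))
  prodUpTo≈∏ zero    f = ≈-refl
  prodUpTo≈∏ (suc m) f = ≈-sym (begin
    ∏[ d < suc m ] f (suc (toℕ d))
      ≈⟨ ∏-init-last {m} (λ d → f (suc (toℕ d))) ⟩
    ∏[ d < m ] f (suc (toℕ (F.inject₁ d))) * f (suc (toℕ (F.fromℕ m)))
      ≈⟨ *-cong (∏-cong {m} (λ d → ≈-reflexive (cong (λ j → f (suc j)) (toℕ-inject₁ d))))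
                (≈-reflexive (cong (λ j → f (suc j)) (toℕ-fromℕ m))) ⟩
    ∏[ d < m ] f (suc (toℕ d)) * f (suc m)
      ≈⟨ *-congʳ (≈-sym (prodUpTo≈∏ m f)) ⟩
    prodUpTo R m f * f (suc m) ∎)

  prodUpTo-trailing-ones : ∀ {k m} {f : ℕ → Carrier} → k ≤ m → (∀ j → k < j → f j ≈ 1#) →
                           prodUpTo R m f ≈ prodUpTo R k f
  prodUpTo-trailing-ones {m = zero} z≤n ones = ≈-refl
  prodUpTo-trailing-ones {m = suc m} k≤1+m ones with ℕₚ.m≤n⇒m<n∨m≡n k≤1+m
  ... | inj₁ k<1+m = ≈-trans (*-cong (prodUpTo-trailing-ones (ℕₚ.≤-pred k<1+m) ones)
                                     (ones (suc m) k<1+m))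
                             (*-identityʳ _)
  ... | inj₂ refl  = ≈-refl

  ∏-single : ∀ {m} (f : Fin m → Carrier) (a : Fin m) → (∀ b → b ≢ a → f b ≈ 1#) → ∏ f ≈ f a
  ∏-single {suc m} f a ones = begin
    ∏ f                                 ≈⟨ ∏-remove {i = a} f ⟩
    f a * ∏[ b < m ] f (F.punchIn a b)  ≈⟨ *-congˡ (∏-cong {m} (λ b → ones _ (punchInᵢ≢i a b))) ⟩
    f a * ∏[ _ < m ] 1#                 ≈⟨ *-congˡ (∏-replicate-1 m) ⟩
    f a * 1#                            ≈⟨ *-identityʳ _ ⟩
    f a                                 ∎

  invMonomial : (ℕ → Carrier) → ∀ {m} → Permutation′ m → Carrier
  invMonomial x {m} σ = prodUpTo R m (λ j → pow R (x j) (invAt σ j))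

  invMonomial-by-pairs : ∀ {m} (x : ℕ → Carrier) (σ : Permutation′ m) →
    invMonomial x σ ≈ ∏[ a < m ] ∏[ b < m ] pow R (x (val σ b)) (inversion σ a b)
  invMonomial-by-pairs {m} x σ = begin
    invMonomial x σ
      ≈⟨ prodUpTo≈∏ m _ ⟩
    ∏[ d < m ] pow R (x (suc (toℕ d))) (invAt σ (suc (toℕ d)))
      ≈⟨ ∏-cong {m} (λ d → ≈-trans (pow-sumFin {m} _ _) (∏-cong {m} (λ a → pow-sumFin {m} _ _))) ⟩
    ∏[ d < m ] ∏[ a < m ] ∏[ b < m ] term a b d
      ≈⟨ ∏-comm {m} {m} _ ⟩
    ∏[ a < m ] ∏[ d < m ] ∏[ b < m ] term a b d
      ≈⟨ ∏-cong {m} (λ a → ∏-comm {m} {m} _) ⟩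
    ∏[ a < m ] ∏[ b < m ] ∏[ d < m ] term a b d
      ≈⟨ ∏-cong {m} (λ a → ∏-cong {m} (λ b → ∏-single (term a b) (σ ⟨$⟩ʳ b) (term-off a b))) ⟩
    ∏[ a < m ] ∏[ b < m ] term a b (σ ⟨$⟩ʳ b)
      ≈⟨ ∏-cong {m} (λ a → ∏-cong {m} (λ b → ≈-reflexive (cong (pow R (x (val σ b)))
           (trans (cong (inversion σ a b ℕ.*_) (ind-yes refl (val σ b ℕ.≟ val σ b)))
                  (ℕₚ.*-identityʳ (inversion σ a b)))))) ⟩
    ∏[ a < m ] ∏[ b < m ] pow R (x (val σ b)) (inversion σ a b) ∎
    where
    term : Fin m → Fin m → Fin m → Carrier
    term a b d = pow R (x (suc (toℕ d))) (inversion σ a b ℕ.* ind (val σ b ℕ.≟ suc (toℕ d)))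

    term-off : ∀ a b d → d ≢ σ ⟨$⟩ʳ b → term a b d ≈ 1#
    term-off a b d d≢σb = ≈-reflexive (cong (pow R (x (suc (toℕ d))))
      (trans (cong (inversion σ a b ℕ.*_)
                   (ind-no (λ eq → d≢σb (sym (toℕ-injective (ℕₚ.suc-injective eq))))
                           (val σ b ℕ.≟ suc (toℕ d))))
             (ℕₚ.*-zeroʳ (inversion σ a b))))

  ∏-pow-below : ∀ {m} (σ : Permutation′ m) (x : ℕ → Carrier) {k} → k ≤ m →
    ∏[ b < m ] pow R (x (val σ b)) (ind (val σ b <? suc k)) ≈ prodUpTo R k x
  ∏-pow-below {m} σ x {k} k≤m = begin
    ∏[ b < m ] f (val σ b)      ≈⟨ ≈-sym (∏-permute (λ d → f (suc (toℕ d))) σ) ⟩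
    ∏[ d < m ] f (suc (toℕ d))  ≈⟨ ≈-sym (prodUpTo≈∏ m f) ⟩
    prodUpTo R m f              ≈⟨ prodUpTo-trailing-ones k≤m beyond ⟩
    prodUpTo R k f              ≈⟨ prodUpTo-cong k within ⟩
    prodUpTo R k x              ∎
    where
    f : ℕ → Carrier
    f j = pow R (x j) (ind (j <? suc k))

    beyond : ∀ j → k < j → f j ≈ 1#
    beyond j k<j = ≈-reflexive (cong (pow R (x j))
      (ind-no (λ j<1+k → ℕₚ.<⇒≱ k<j (ℕₚ.≤-pred j<1+k)) (j <? suc k)))

    within : ∀ j → j ≤ k → f j ≈ x j
    within j j≤k = ≈-trans (≈-reflexive (cong (pow R (x j)) (ind-yes (s≤s j≤k) (j <? suc k)))) (*-identityʳ _)

  substX-below : ∀ t x {i N j} → j < i → substX R t x i N j ≈ x j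
  substX-below t x {i} {N} {j} j<i with j <? i
  ... | yes _   = ≈-refl
  ... | no j≮i = ⊥-elim (j≮i j<i)

  substX-above : ∀ t x {i N j} → i ≤ j → j ≤ N → substX R t x i N j ≈ t * x (suc j)
  substX-above t x {i} {N} {j} i≤j j≤N with j <? i | j ℕ.≤? N
  ... | yes j<i | _       = ⊥-elim (ℕₚ.<⇒≱ j<i i≤j)
  ... | no _    | yes _   = ≈-refl
  ... | no _    | no j≰N = ⊥-elim (j≰N j≤N)

  module _ (t : Carrier) (x : ℕ → Carrier) {n} (π : Permutation′ (suc n)) (π' : Permutation′ n)
           (red : IsRedTail π π') where
    open HeadTail π π' red

    y : ℕ → Carrier
    y = substX R t x i n

    substX-tail : ∀ b → y (val π' b) ≈ pow R t (above b) * x (val π (F.suc b))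
    substX-tail b = byPosition (i <? val π (F.suc b))
      where
      byPosition : (d : Dec (i < val π (F.suc b))) →
                   y (val π' b) ≈ pow R t (ind d) * x (val π (F.suc b))
      byPosition (yes i<w) = begin
        y (val π' b)                    ≈⟨ substX-above t x i≤w' (toℕ<n (π' ⟨$⟩ʳ b)) ⟩
        t * x (suc (val π' b))          ≈⟨ *-cong (≈-sym (*-identityʳ t))
                                                  (≈-reflexive (cong x (sym w≡1+w'))) ⟩
        (t * 1#) * x (val π (F.suc b))  ∎
        where
        w≡1+w' = val-tail-above b i<w
        i≤w' = ℕₚ.≤-pred (subst (i <_) w≡1+w' i<w)
      byPosition (no i≮w) with ℕₚ.≤∧≢⇒< (ℕₚ.≮⇒≥ i≮w) (val-tail≢head b)
      ... | w<i rewrite val-tail-below b i≮w = ≈-trans (substX-below t x w<i) (≈-sym (*-identityˡ _))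

    tailMonomial : Carrier
    tailMonomial = ∏[ a < n ] ∏[ b < n ] pow R (x (val π (F.suc b))) (inversion π' a b)

    invMonomial-head-tail : invMonomial x π ≈ prodUpTo R (i ∸ 1) x * tailMonomial
    invMonomial-head-tail = ≈-trans (invMonomial-by-pairs x π) (*-cong headRow (∏-cong {n} tailRow))
      where
      headRow : ∏[ b < suc n ] pow R (x (val π b)) (inversion π zero b) ≈ prodUpTo R (i ∸ 1) x
      headRow = ≈-trans
        (∏-cong {suc n} (λ b → ≈-reflexive (cong (pow R (x (val π b))) (inversion-from-zero π b))))
        (∏-pow-below π x (ℕₚ.<⇒≤ (toℕ<n (π ⟨$⟩ʳ zero))))

      tailRow : ∀ a → ∏[ b < suc n ] pow R (x (val π b)) (inversion π (F.suc a) b)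
                      ≈ ∏[ b < n ] pow R (x (val π (F.suc b))) (inversion π' a b)
      tailRow a = ≈-trans
        (*-cong (≈-reflexive (cong (pow R (x i)) (inversion-to-zero π (F.suc a))))
                (∏-cong {n} (λ b → ≈-reflexive (cong (pow R (x (val π (F.suc b))))
                                                      (inversion-tail a b)))))
        (*-identityˡ _)

    invMonomial-substX : invMonomial y π' ≈ pow R t headOccurrences * tailMonomial
    invMonomial-substX = begin
      invMonomial y π'
        ≈⟨ invMonomial-by-pairs y π' ⟩
      ∏[ a < n ] ∏[ b < n ] pow R (y (val π' b)) (inversion π' a b)
        ≈⟨ ∏-cong {n} (λ a → ∏-cong {n} (λ b → factor a b)) ⟩
      ∏[ a < n ] ∏[ b < n ] (pow R t (inversion π' a b ℕ.* above b)
                             * pow R (x (val π (F.suc b))) (inversion π' a b))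
        ≈⟨ ≈-trans (∏-cong {n} (λ a → ∏-distrib-* {n} _ _)) (∏-distrib-* {n} _ _) ⟩
      ∏[ a < n ] ∏[ b < n ] pow R t (inversion π' a b ℕ.* above b) * tailMonomial
        ≈⟨ *-congʳ (≈-sym (≈-trans (pow-sumFin {n} t _) (∏-cong {n} (λ a → pow-sumFin {n} t _)))) ⟩
      pow R t headOccurrences * tailMonomial ∎
      where
      factor : ∀ a b → pow R (y (val π' b)) (inversion π' a b)
                       ≈ pow R t (inversion π' a b ℕ.* above b)
                         * pow R (x (val π (F.suc b))) (inversion π' a b)
      factor a b = ≈-trans (pow-congˡ e (substX-tail b))
        (≈-trans (pow-distrib-* (pow R t (above b)) _ e)
          (*-congʳ (≈-trans (pow-assocʳ t (above b) e)
                            (≈-reflexive (cong (pow R t) (ℕₚ.*-comm (above b) e))))))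
        where e = inversion π' a b

    weight-head-tail : weight R t x π ≈ prodUpTo R (i ∸ 1) x * weight R t y π'
    weight-head-tail = begin
      pow R t (N132 π) * invMonomial x π
        ≈⟨ *-cong (≈-reflexive (cong (pow R t) N132-head-tail)) invMonomial-head-tail ⟩
      pow R t (headOccurrences + N132 π') * (low * tailMonomial)
        ≈⟨ *-congʳ (pow-homo-+ t headOccurrences (N132 π')) ⟩
      (pow R t headOccurrences * pow R t (N132 π')) * (low * tailMonomial)
        ≈⟨ solve 4 (λ a b c d → (a ⊕ b) ⊕ (c ⊕ d) ⊜ c ⊕ (b ⊕ (a ⊕ d))) ≈-refl _ _ _ _ ⟩
      low * (pow R t (N132 π') * (pow R t headOccurrences * tailMonomial))
        ≈⟨ *-congˡ (*-congˡ (≈-sym invMonomial-substX)) ⟩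
      low * weight R t y π' ∎
      where
      open CommutativeMonoidSolver *-commutativeMonoid using (solve; _⊕_; _⊜_)
      low = prodUpTo R (i ∸ 1) x

mainTheorem1 : ∀ {c ℓ} (R : CommutativeSemiring c ℓ)
    (t : CommutativeSemiring.Carrier R) (x : ℕ → CommutativeSemiring.Carrier R)
    (n : ℕ) (π : Permutation′ (suc n)) (π' : Permutation′ n) →
    IsRedTail π π' →
    CommutativeSemiring._≈_ R (weight R t x π)
      (CommutativeSemiring._*_ R (prodUpTo R (val π zero ∸ 1) x)
        (weight R t (substX R t x (val π zero) n) π'))
mainTheorem1 R t x n π π' red = weight-head-tail R t x π π' red
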